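{- For $n\ge0$ let $Q_n=[0,n]^2$ (grid graph) and $\underline{Q}=(Q_n)_{n\ge0}$. Let $\underline{v}=(v_n)_{n\ge0}$ be a valid sequence of activated vertices in $\underline{Q}$ such that $v_1=\bullet$ or $v_2=\bullet$, and such that for every $n$ with $v_n\neq\bullet$, $v_n$ is, among the vertices of $Q_n$ that are unburned (i.e., not in $N_{Q_n}[B_{n-1}]$; for $n=0$, any vertex of $Q_0$) and at minimum $L_1$-distance from $(0,0)$, the one with the greatest $y$-coordinate. Then for every $n\ge1$, \[|B_n|\leq\frac{(n+2)(n+1)}{2}+(2+\log_2 n)(n+1).\]
   Context: $[0,n]^2$ denotes the graph on vertex set $[0,n]^2\subset\mathbb{Z}^2$ in which two vertices are adjacent iff their $L_1$-distance is $1$. Burning process: let $\underline{G}=(G_0,G_1,\dots)$ be graphs with $G_{n-1}$ an induced subgraph of $G_n$ for all $n\ge1$. A sequence of activated vertices is $\underline{v}=(v_n)_{n\ge0}$ with $v_n\in V(G_n)\cup\{\bullet\}$ ($\bullet$ means no vertex is activated). Burning sets: $B_0=\{v_0\}$ (empty if $v_0=\bullet$), and $B_{n+1}=N_{G_{n+1}}[B_n]$ if $v_{n+1}=\bullet$, and $B_{n+1}=N_{G_{n+1}}[B_n]\cup\{v_{n+1}\}$ otherwise, where $N_G[X]$ is the closed neighbourhood of $X$ in $G$. The sequence is valid if for every $n\ge0$ with $v_{n+1}\neq\bullet$, $v_{n+1}\in V(G_{n+1})\setminus N_{G_{n+1}}[B_n]$. -}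

module Defs where

open import Data.Nat using (ℕ; zero; suc; _+_; _≤ᵇ_; _≡ᵇ_; ∣_-_∣)
open import Data.Bool using (Bool; true; false; _∧_; _∨_; not)
open import Data.Product using (_×_; _,_; proj₁; proj₂)
open import Data.Maybe using (Maybe; just; nothing)
open import Data.List using (List; []; _∷_; upTo; concatMap; map; filter; length)
open import Data.Bool.ListAction using (any)
open import Relation.Binary.PropositionalEquality using (_≡_)
open import Relation.Nullary.Decidable using (does)
open import Function using (_∘_)

Vertex : Set
Vertex = ℕ × ℕ

-- A sequence of activated vertices: nothing represents • (no activation).
Activation : Set
Activation = ℕ → Maybe Vertex

inQ : ℕ → Vertex → Bool
inQ n (x , y) = (x ≤ᵇ n) ∧ (y ≤ᵇ n)

dist₁ : Vertex → Vertex → ℕ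
dist₁ (x , y) (x' , y') = ∣ x - x' ∣ + ∣ y - y' ∣

gridList : ℕ → List Vertex
gridList n = concatMap (λ x → map (λ y → (x , y)) (upTo (suc n))) (upTo (suc n))

-- closed neighbourhood N_{Q_n}[X] of a (decidable) vertex set X:
-- p ∈ V(Q_n) and some q ∈ V(Q_n) ∩ X has L1-distance ≤ 1 from p
-- (distance 0 gives p itself, distance 1 gives the grid neighbours).
closedNbhd : ℕ → (Vertex → Bool) → Vertex → Bool
closedNbhd n X p = inQ n p ∧ any (λ q → X q ∧ (dist₁ p q ≤ᵇ 1)) (gridList n)

activatedAt : Maybe Vertex → Vertex → Bool
activatedAt nothing p = false
activatedAt (just (a , b)) (x , y) = (a ≡ᵇ x) ∧ (b ≡ᵇ y)

burned : Activation → ℕ → Vertex → Bool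
burned v zero p = activatedAt (v zero) p
burned v (suc n) p = closedNbhd (suc n) (burned v n) p ∨ activatedAt (v (suc n)) p

-- |B_n|  (B_n ⊆ V(Q_n) for valid sequences, so we count inside V(Q_n))
card : Activation → ℕ → ℕ
card v n = length (filter (λ p → burned v n p ≡? true) (gridList n))
  where
  open import Data.Bool.Properties using () renaming (_≟_ to _≡?_)

Valid : Activation → Set
Valid v = (∀ n p → v n ≡ just p → inQ n p ≡ true)
        × (∀ n p → v (suc n) ≡ just p → closedNbhd (suc n) (burned v n) p ≡ false)

unburned : Activation → ℕ → Vertex → Bool
unburned v zero p = inQ zero p
unburned v (suc n) p = inQ (suc n) p ∧ not (closedNbhd (suc n) (burned v n) p)

norm₁ : Vertex → ℕ
norm₁ (x , y) = x + y

Greedy : Activation → Set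
Greedy v = ∀ n p → v n ≡ just p →
    (unburned v n p ≡ true)
  × (∀ q → unburned v n q ≡ true → norm₁ p Data.Nat.≤ norm₁ q)
  × (∀ q → unburned v n q ≡ true → norm₁ q ≡ norm₁ p → proj₂ q Data.Nat.≤ proj₂ p)
  where import Data.Nat

{-# OPTIONS --safe #-}
-- The offset of a vertex activated at time k is its L1-norm minus k.  As the
-- greedy rule activates an unburned vertex of least norm, a fire of offset
-- o + 1 or more at time j means that (j, o) was burned earlier, necessarily by
-- a fire of offset exactly o lying no higher than (j, o).  On the other hand, if no
-- fire reaches offset o before time t, then a fire of offset o at time i lies
-- at height at least 2t - i: the lower vertices of its anti-diagonal could only
-- have been burned by earlier and even lower fires of offset o.  Together these
-- show that offset m + 2 is first reached no earlier than time 2^m + m + 2 (for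
-- m = 0 this is where v₁ = • or v₂ = • is needed).  So if 2^m ≤ n < 2^(m+1),
-- every fire up to time n has offset at most m + 2, B_n lies in the L1-ball of
-- radius n + m + 2, and counting the points of Q_n in that ball column by
-- column gives the bound.

module Submission where

open import Defs
open import Data.Nat using (ℕ; _+_; _*_; _∸_; _^_; _≤_)
open import Data.Maybe using (nothing)
open import Data.Sum using (_⊎_)
open import Relation.Binary.PropositionalEquality using (_≡_)

open import Data.Bool using (Bool; true; false; _∧_; _∨_)
open import Data.Bool.ListAction using (any)
open import Data.Bool.Properties using (T-≡) renaming (_≟_ to _≟ᵇ_)
open import Data.Empty using (⊥-elim)
open import Data.List using (List; []; _∷_; [_]; _++_; _∷ʳ_; map; concatMap; filter; length; upTo; applyUpTo)
open import Data.List.Properties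
  using (filter-++; filter-reject; length-++; length-filter; length-map; length-upTo; map-++; map-upTo; ++-identityʳ; upTo-∷ʳ)
open import Data.List.Relation.Binary.Sublist.Propositional using (⊆-refl)
open import Data.List.Relation.Binary.Sublist.Propositional.Properties using (filter⁺; length-mono-≤)
open import Data.Maybe using (Maybe; just)
open import Data.Nat using (zero; suc; _<_; _≤?_; _≤ᵇ_; _≡ᵇ_; z≤n; s≤s; s≤s⁻¹; ∣_-_∣)
open import Data.Nat.Induction using (<-rec)
open import Data.Nat.ListAction using (sum)
open import Data.Nat.Properties
open import Algebra.Properties.CommutativeSemigroup +-commutativeSemigroup using (interchange; xy∙z≈zy∙x)
open import Data.Nat.Tactic.RingSolver using (solve-∀)
open import Data.Product using (_×_; _,_; proj₁; proj₂; ∃-syntax)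
open import Data.Sum using (inj₁; inj₂)
open import Function using (_∘_; Equivalence)
open import Relation.Binary.PropositionalEquality using (refl; sym; trans; cong; subst; module ≡-Reasoning)
open import Relation.Nullary using (¬_; yes; no; contradiction)
open import Relation.Unary using (Decidable)

private
  variable
    h i j k n o r t x y : ℕ
    p q : Vertex
    v : Activation

∧≡true : ∀ {a b} → a ∧ b ≡ true → a ≡ true × b ≡ true
∧≡true {true} b≡true = refl , b≡true
∧≡true {false} ()

∨≡true : ∀ {a b} → a ∨ b ≡ true → a ≡ true ⊎ b ≡ true
∨≡true {true}  _      = inj₁ refl
∨≡true {false} b≡true = inj₂ b≡true

any≡true : {A : Set} (f : A → Bool) (xs : List A) → any f xs ≡ true → ∃[ a ] f a ≡ true
any≡true f (a ∷ xs) e with f a in fa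
... | true  = a , fa
... | false = any≡true f xs e

≤ᵇ≡true⇒≤ : (x ≤ᵇ y) ≡ true → x ≤ y
≤ᵇ≡true⇒≤ {x} {y} e = ≤ᵇ⇒≤ x y (Equivalence.from T-≡ e)

≡ᵇ≡true⇒≡ : (x ≡ᵇ y) ≡ true → x ≡ y
≡ᵇ≡true⇒≡ {x} {y} e = ≡ᵇ⇒≡ x y (Equivalence.from T-≡ e)

≤⇒≤ᵇ≡true : x ≤ y → (x ≤ᵇ y) ≡ true
≤⇒≤ᵇ≡true x≤y = Equivalence.to T-≡ (≤⇒≤ᵇ x≤y)

inQ⇒≤ : inQ n (x , y) ≡ true → x ≤ n × y ≤ n
inQ⇒≤ e with ∧≡true e
... | x≤n , y≤n = ≤ᵇ≡true⇒≤ x≤n , ≤ᵇ≡true⇒≤ y≤n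

≤⇒inQ : x ≤ n → y ≤ n → inQ n (x , y) ≡ true
≤⇒inQ x≤n y≤n rewrite ≤⇒≤ᵇ≡true x≤n | ≤⇒≤ᵇ≡true y≤n = refl

activatedAt⇒≡ : ∀ (a : Maybe Vertex) p → activatedAt a p ≡ true → a ≡ just p
activatedAt⇒≡ (just (a , b)) (x , y) e with ∧≡true e
... | a≡x , b≡y rewrite ≡ᵇ≡true⇒≡ {a} a≡x | ≡ᵇ≡true⇒≡ {b} b≡y = refl

dist₁-refl : ∀ p → dist₁ p p ≡ 0
dist₁-refl (x , y) rewrite ∣n-n∣≡0 x | ∣n-n∣≡0 y = refl

dist₁-triangle : ∀ p q r → dist₁ p r ≤ dist₁ p q + dist₁ q r
dist₁-triangle (a , b) (c , d) (e , f) = begin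
  ∣ a - e ∣ + ∣ b - f ∣                              ≤⟨ +-mono-≤ (∣-∣-triangle a c e) (∣-∣-triangle b d f) ⟩
  (∣ a - c ∣ + ∣ c - e ∣) + (∣ b - d ∣ + ∣ d - f ∣)  ≡⟨ interchange ∣ a - c ∣ ∣ c - e ∣ ∣ b - d ∣ ∣ d - f ∣ ⟩
  (∣ a - c ∣ + ∣ b - d ∣) + (∣ c - e ∣ + ∣ d - f ∣)  ∎
  where open ≤-Reasoning

norm₁≤norm₁+dist₁ : ∀ p q → norm₁ p ≤ norm₁ q + dist₁ p q
norm₁≤norm₁+dist₁ (a , b) (c , d) = begin
  a + b                              ≤⟨ +-mono-≤ (m≤n+∣m-n∣ a c) (m≤n+∣m-n∣ b d) ⟩
  (c + ∣ a - c ∣) + (d + ∣ b - d ∣)  ≡⟨ interchange c ∣ a - c ∣ d ∣ b - d ∣ ⟩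
  (c + d) + (∣ a - c ∣ + ∣ b - d ∣)  ∎
  where open ≤-Reasoning

norm₁-reach : ∀ p q {k r} → dist₁ p q + k ≤ r → norm₁ p + k ≤ norm₁ q + r
norm₁-reach p q {k} {r} reach = begin
  norm₁ p + k                    ≤⟨ +-monoˡ-≤ k (norm₁≤norm₁+dist₁ p q) ⟩
  (norm₁ q + dist₁ p q) + k      ≡⟨ +-assoc (norm₁ q) (dist₁ p q) k ⟩
  norm₁ q + (dist₁ p q + k)      ≤⟨ +-monoʳ-≤ (norm₁ q) reach ⟩
  norm₁ q + r                    ∎
  where open ≤-Reasoning

norm₁+dist₁≤norm₁⇒proj₂≤proj₂ : ∀ p q → norm₁ q + dist₁ p q ≤ norm₁ p → proj₂ q ≤ proj₂ p
norm₁+dist₁≤norm₁⇒proj₂≤proj₂ (a , b) (c , d) short = m+n≤o⇒m≤o d (+-cancelʳ-≤ (c + ∣ a - c ∣) (d + ∣ b - d ∣) b (begin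
  (d + ∣ b - d ∣) + (c + ∣ a - c ∣)  ≡⟨ rearrange d ∣ b - d ∣ c ∣ a - c ∣ ⟩
  (c + d) + (∣ a - c ∣ + ∣ b - d ∣)  ≤⟨ short ⟩
  a + b                              ≤⟨ +-monoˡ-≤ b (m≤n+∣m-n∣ a c) ⟩
  (c + ∣ a - c ∣) + b                ≡⟨ +-comm (c + ∣ a - c ∣) b ⟩
  b + (c + ∣ a - c ∣)                ∎))
  where
  open ≤-Reasoning
  rearrange : ∀ d B c A → (d + B) + (c + A) ≡ (c + d) + (A + B)
  rearrange = solve-∀

kindler-on-band : ∀ p q {k i o} → dist₁ p q + k ≤ i → norm₁ p ≡ i + o → norm₁ q ≤ k + o →
                  norm₁ q ≡ k + o × proj₂ q ≤ proj₂ p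
kindler-on-band p q {k} {i} {o} reach on-band below = on-band′ , norm₁+dist₁≤norm₁⇒proj₂≤proj₂ p q shortcut
  where
  open ≤-Reasoning
  on-band′ : norm₁ q ≡ k + o
  on-band′ = ≤-antisym below (+-cancelʳ-≤ i (k + o) (norm₁ q) (begin
    (k + o) + i  ≡⟨ xy∙z≈zy∙x k o i ⟩
    (i + o) + k  ≡⟨ cong (_+ k) on-band ⟨
    norm₁ p + k  ≤⟨ norm₁-reach p q reach ⟩
    norm₁ q + i  ∎))
  shortcut : norm₁ q + dist₁ p q ≤ norm₁ p
  shortcut = +-cancelʳ-≤ k (norm₁ q + dist₁ p q) (norm₁ p) (begin
    (norm₁ q + dist₁ p q) + k  ≡⟨ +-assoc (norm₁ q) (dist₁ p q) k ⟩
    norm₁ q + (dist₁ p q + k)  ≤⟨ +-monoʳ-≤ (norm₁ q) reach ⟩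
    norm₁ q + i                ≡⟨ cong (_+ i) on-band′ ⟩
    (k + o) + i                ≡⟨ xy∙z≈zy∙x k o i ⟩
    (i + o) + k                ≡⟨ cong (_+ k) on-band ⟨
    norm₁ p + k                ∎)

band-vertex : o ≤ h → h ≤ i → ∃[ x ] inQ i (x , h) ≡ true × x + h ≡ i + o
band-vertex {o} {h} {i} o≤h h≤i = i + o ∸ h , ≤⇒inQ x≤i h≤i , m∸n+n≡m (≤-trans h≤i (m≤m+n i o))
  where
  x≤i : i + o ∸ h ≤ i
  x≤i = m≤n+o⇒m∸n≤o (i + o) h (≤-trans (+-monoʳ-≤ i o≤h) (≤-reflexive (+-comm i h)))

FarFiresFrom : Activation → ℕ → ℕ → Set
FarFiresFrom v o t = ∀ {k q} → v k ≡ just q → k + o ≤ norm₁ q → t ≤ k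

NearFiresBefore : Activation → ℕ → ℕ → Set
NearFiresBefore v o t = ∀ {k q} → k < t → v k ≡ just q → norm₁ q ≤ k + o

¬far⇒near : (∀ {k q} → k < t → v k ≡ just q → ¬ (k + suc o ≤ norm₁ q)) → NearFiresBefore v o t
¬far⇒near {o = o} not-far {k} k<t lit = s≤s⁻¹ (≤-trans (≰⇒> (not-far k<t lit)) (≤-reflexive (+-suc k o)))

far⇒near : FarFiresFrom v (suc o) t → NearFiresBefore v o t
far⇒near far = ¬far⇒near (λ k<t lit far-q → <⇒≱ k<t (far lit far-q))

record Kindled (v : Activation) (t r : ℕ) (p : Vertex) : Set where
  constructor kindled
  field
    time   : ℕ
    origin : Vertex
    lit    : v time ≡ just origin
    early  : time < t
    reach  : dist₁ p origin + time ≤ r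

module _ {v : Activation} where

  activated⇒kindled : ∀ n p → activatedAt (v n) p ≡ true → Kindled v (suc n) n p
  activated⇒kindled n p act = kindled n p (activatedAt⇒≡ (v n) p act) ≤-refl (≤-reflexive (cong (_+ n) (dist₁-refl p)))

  kindled-neighbour : dist₁ p q ≤ 1 → Kindled v t r q → Kindled v t (suc r) p
  kindled-neighbour {p} {q} {r = r} pq≤1 (kindled k s lit early reach) = kindled k s lit early (begin
    dist₁ p s + k                  ≤⟨ +-monoˡ-≤ k (dist₁-triangle p q s) ⟩
    (dist₁ p q + dist₁ q s) + k    ≡⟨ +-assoc (dist₁ p q) (dist₁ q s) k ⟩
    dist₁ p q + (dist₁ q s + k)    ≤⟨ +-mono-≤ pq≤1 reach ⟩
    suc r                          ∎)
    where open ≤-Reasoning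

  burned⇒kindled : ∀ n p → burned v n p ≡ true → Kindled v (suc n) n p
  closedNbhd⇒kindled : ∀ n p → closedNbhd (suc n) (burned v n) p ≡ true → Kindled v (suc n) (suc n) p

  burned⇒kindled zero p act = activated⇒kindled zero p act
  burned⇒kindled (suc n) p e with ∨≡true e
  ... | inj₂ act = activated⇒kindled (suc n) p act
  ... | inj₁ near with closedNbhd⇒kindled n p near
  ...   | kindled k q lit early reach = kindled k q lit (m<n⇒m<1+n early) reach

  closedNbhd⇒kindled n p e with any≡true _ (gridList (suc n)) (proj₂ (∧≡true e))
  ... | q , e′ with ∧≡true e′
  ...   | q-burned , pq≤1 = kindled-neighbour (≤ᵇ≡true⇒≤ pq≤1) (burned⇒kindled n q q-burned)

  unburned⊎kindled : ∀ i p → inQ i p ≡ true → unburned v i p ≡ true ⊎ Kindled v i i p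
  unburned⊎kindled zero p p∈Q = inj₁ p∈Q
  unburned⊎kindled (suc n) p p∈Q with closedNbhd (suc n) (burned v n) p in near
  ... | true  = inj₂ (closedNbhd⇒kindled n p near)
  ... | false rewrite p∈Q = inj₁ refl

  burned⇒norm₁≤ : NearFiresBefore v o (suc n) → burned v n p ≡ true → norm₁ p ≤ n + o
  burned⇒norm₁≤ {o} {n} {p} near e with burned⇒kindled n p e
  ... | kindled k q lit early reach = +-cancelʳ-≤ k (norm₁ p) (n + o) (begin
    norm₁ p + k  ≤⟨ norm₁-reach p q reach ⟩
    norm₁ q + n  ≤⟨ +-monoˡ-≤ n (near early lit) ⟩
    (k + o) + n  ≡⟨ xy∙z≈zy∙x k o n ⟩
    (n + o) + k  ∎)
    where open ≤-Reasoning

module _ {v : Activation} (valid : Valid v) (greedy : Greedy v) where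

  fire-in-grid : v k ≡ just (x , y) → x ≤ k × y ≤ k
  fire-in-grid {k} lit = inQ⇒≤ (proj₁ valid k _ lit)

  fire-norm₁≤ : v k ≡ just q → norm₁ q ≤ k + k
  fire-norm₁≤ {q = x , y} lit with fire-in-grid lit
  ... | x≤k , y≤k = +-mono-≤ x≤k y≤k

  greedy-minimal : v j ≡ just p → unburned v j q ≡ true → norm₁ p ≤ norm₁ q
  greedy-minimal {j} {p} {q} lit = proj₁ (proj₂ (greedy j p lit)) q

  greedy-topmost : v j ≡ just p → unburned v j q ≡ true → norm₁ q ≡ norm₁ p → proj₂ q ≤ proj₂ p
  greedy-topmost {j} {p} {q} lit = proj₂ (proj₂ (greedy j p lit)) q

  greedy-kindled : v j ≡ just p → inQ j q ≡ true → norm₁ q < norm₁ p → Kindled v j j q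
  greedy-kindled {j} {p} {q} lit q∈Q q<p with unburned⊎kindled j q q∈Q
  ... | inj₁ fresh = contradiction (greedy-minimal lit fresh) (<⇒≱ q<p)
  ... | inj₂ κ     = κ

  HighOnBand : ℕ → ℕ → ℕ → Set
  HighOnBand o t i = ∀ {x y} → NearFiresBefore v o i → v i ≡ just (x , y) → x + y ≡ i + o → t + t ≤ y + i

  -- A kindler of p would be an earlier fire of offset o no higher than p, below the height guaranteed by high.
  low-band-vertex-unburned : (∀ {k} → k < i → HighOnBand o t k) → NearFiresBefore v o i →
                             inQ i p ≡ true → norm₁ p ≡ i + o → proj₂ p + i ≤ t + t → unburned v i p ≡ true
  low-band-vertex-unburned {i} {o} {t} {p} high near p∈Q on-band low with unburned⊎kindled i p p∈Q
  ... | inj₁ fresh = fresh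
  ... | inj₂ (kindled k (a , b) lit k<i reach) = contradiction (high k<i near-before-k lit a+b≡k+o) (<⇒≱ (begin-strict
    b + k            ≤⟨ +-monoˡ-≤ k b≤h ⟩
    proj₂ p + k      <⟨ +-monoʳ-< (proj₂ p) k<i ⟩
    proj₂ p + i      ≤⟨ low ⟩
    t + t            ∎))
    where
    open ≤-Reasoning
    near-before-k : NearFiresBefore v o k
    near-before-k k′<k = near (<-trans k′<k k<i)
    a+b≡k+o : a + b ≡ k + o
    a+b≡k+o = proj₁ (kindler-on-band p (a , b) reach on-band (near k<i lit))
    b≤h : b ≤ proj₂ p
    b≤h = proj₂ (kindler-on-band p (a , b) reach on-band (near k<i lit))

  band-height : FarFiresFrom v o t → ∀ i → HighOnBand o t i
  band-height {o} {t} far = <-rec (HighOnBand o t) climb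
    where
    climb : ∀ i → (∀ {k} → k < i → HighOnBand o t k) → HighOnBand o t i
    climb i high {x} {y} near lit on-band with t + t ≤? i + o
    ... | yes 2t≤i+o = ≤-trans 2t≤i+o (begin
      i + o  ≤⟨ +-monoʳ-≤ i o≤y ⟩
      i + y  ≡⟨ +-comm i y ⟩
      y + i  ∎)
      where
      open ≤-Reasoning
      o≤y : o ≤ y
      o≤y = +-cancelˡ-≤ i o y (begin
        i + o  ≡⟨ on-band ⟨
        x + y  ≤⟨ +-monoˡ-≤ y (proj₁ (fire-in-grid lit)) ⟩
        i + y  ∎)
    -- Otherwise the vertex of norm i + o at height 2t - i is still unburned, and v i lies at least as high.
    ... | no 2t≰i+o = from-height (m≤n⇒∃[o]m+o≡n (≤-trans (m≤m+n i o) (<⇒≤ i+o<2t)))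
      where
      open ≤-Reasoning
      i+o<2t : i + o < t + t
      i+o<2t = ≰⇒> 2t≰i+o
      t≤i : t ≤ i
      t≤i = far lit (≤-reflexive (sym on-band))
      from-height : ∃[ h ] i + h ≡ t + t → t + t ≤ y + i
      from-height (h , i+h≡2t) = let x′ , probe∈Q , probe-on-band = band-vertex o≤h h≤i in begin
        t + t  ≡⟨ h+i≡2t ⟨
        h + i  ≤⟨ +-monoˡ-≤ i (greedy-topmost lit
                    (low-band-vertex-unburned {t = t} high near probe∈Q probe-on-band (≤-reflexive h+i≡2t))
                    (trans probe-on-band (sym on-band))) ⟩
        y + i  ∎
        where
        h+i≡2t : h + i ≡ t + t
        h+i≡2t = trans (+-comm h i) i+h≡2t
        o≤h : o ≤ h
        o≤h = +-cancelˡ-≤ i o h (≤-trans (<⇒≤ i+o<2t) (≤-reflexive (sym i+h≡2t)))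
        h≤i : h ≤ i
        h≤i = +-cancelˡ-≤ i h i (≤-trans (≤-reflexive i+h≡2t) (+-mono-≤ t≤i t≤i))

  -- At time 2, the vertex (2, 1) is closer to the origin than a fire of offset 2, so it was burned by
  -- v₀ = (0, 0), which is too far away, or by v₁, which cannot coexist with v₂.
  far-fires-from-2 : (v 1 ≡ nothing ⊎ v 2 ≡ nothing) → FarFiresFrom v 2 3
  far-fires-from-2 quiet {zero} lit far = contradiction (≤-trans far (fire-norm₁≤ lit)) λ ()
  far-fires-from-2 quiet {1} lit far = contradiction (≤-trans far (fire-norm₁≤ lit)) λ { (s≤s (s≤s ())) }
  far-fires-from-2 quiet {2} lit far with greedy-kindled {q = 2 , 1} lit (≤⇒inQ {n = 2} ≤-refl (s≤s z≤n)) far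
  ... | kindled zero q lit₀ _ reach =
    contradiction (≤-trans (norm₁-reach (2 , 1) q reach) (+-monoˡ-≤ 2 (fire-norm₁≤ lit₀))) λ { (s≤s (s≤s ())) }
  ... | kindled 1 q lit₁ _ _ = ⊥-elim (not-quiet quiet)
    where
    not-quiet : ¬ (v 1 ≡ nothing ⊎ v 2 ≡ nothing)
    not-quiet (inj₁ v₁≡•) = contradiction (trans (sym v₁≡•) lit₁) λ ()
    not-quiet (inj₂ v₂≡•) = contradiction (trans (sym v₂≡•) lit) λ ()
  ... | kindled (suc (suc _)) _ _ (s≤s (s≤s ())) _
  far-fires-from-2 quiet {suc (suc (suc k))} _ _ = s≤s (s≤s (s≤s z≤n))

  -- A fire of offset o + 1 at time j finds (j, o) burned by an earlier fire of offset o below it,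
  -- which band-height places at a time k with 2t ≤ o + k.
  far-fires-step : ∀ {o t t′} → FarFiresFrom v o t → t′ + o ≤ suc (t + t) → FarFiresFrom v (suc o) t′
  far-fires-step {o} {t} {t′} far bound {j} = <-rec LateIfFar late j
    where
    LateIfFar : ℕ → Set
    LateIfFar j = ∀ {q} → v j ≡ just q → j + suc o ≤ norm₁ q → t′ ≤ j
    late : ∀ j → (∀ {k} → k < j → LateIfFar k) → LateIfFar j
    late j earlier {q} lit far-q with t′ ≤? j
    ... | yes t′≤j = t′≤j
    ... | no t′≰j = from-kindler (greedy-kindled lit (≤⇒inQ ≤-refl (<⇒≤ o<j)) j+o<norm)
      where
      open ≤-Reasoning
      near : NearFiresBefore v o j
      near = ¬far⇒near (λ k<j lit′ far′ → t′≰j (≤-trans (earlier k<j lit′ far′) (<⇒≤ k<j)))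
      o<j : o < j
      o<j = +-cancelˡ-≤ j (suc o) j (≤-trans far-q (fire-norm₁≤ lit))
      j+o<norm : j + o < norm₁ q
      j+o<norm = ≤-trans (≤-reflexive (sym (+-suc j o))) far-q
      from-kindler : Kindled v j j (j , o) → t′ ≤ j
      from-kindler (kindled k (a , b) lit′ k<j reach) = +-cancelʳ-≤ o t′ j (begin
        t′ + o       ≤⟨ bound ⟩
        suc (t + t)  ≤⟨ s≤s (band-height far k (λ k′<k → near (<-trans k′<k k<j)) lit′ (proj₁ band)) ⟩
        suc (b + k)  ≤⟨ s≤s (+-monoˡ-≤ k (proj₂ band)) ⟩
        suc (o + k)  ≡⟨ +-suc o k ⟨
        o + suc k    ≤⟨ +-monoʳ-≤ o k<j ⟩
        o + j        ≡⟨ +-comm o j ⟩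
        j + o        ∎)
        where
        band : a + b ≡ k + o × b ≤ o
        band = kindler-on-band (j , o) (a , b) reach refl (near k<j lit′)

  far-fires : (v 1 ≡ nothing ⊎ v 2 ≡ nothing) → ∀ m → FarFiresFrom v (m + 2) (2 ^ m + (m + 2))
  far-fires quiet zero    = far-fires-from-2 quiet
  far-fires quiet (suc m) = far-fires-step (far-fires quiet m) (≤-reflexive (doubling (2 ^ m) m))
    where
    doubling : ∀ P m → (2 * P + (suc m + 2)) + (m + 2) ≡ suc ((P + (m + 2)) + (P + (m + 2)))
    doubling = solve-∀

length-filter-concatMap : {A B : Set} {P : B → Set} (P? : Decidable P) (f : A → List B) (xs : List A) →
                          length (filter P? (concatMap f xs)) ≡ sum (map (length ∘ filter P? ∘ f) xs)
length-filter-concatMap P? f []       = refl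
length-filter-concatMap P? f (x ∷ xs) = begin
  length (filter P? (f x ++ concatMap f xs))                      ≡⟨ cong length (filter-++ P? (f x) _) ⟩
  length (filter P? (f x) ++ filter P? (concatMap f xs))          ≡⟨ length-++ (filter P? (f x)) ⟩
  length (filter P? (f x)) + length (filter P? (concatMap f xs))  ≡⟨ cong (_ +_) (length-filter-concatMap P? f xs) ⟩
  length (filter P? (f x)) + sum (map (length ∘ filter P? ∘ f) xs) ∎
  where open ≡-Reasoning

sum-map-mono-≤ : {A : Set} {f g : A → ℕ} → (∀ a → f a ≤ g a) → (xs : List A) → sum (map f xs) ≤ sum (map g xs)
sum-map-mono-≤ f≤g []       = z≤n
sum-map-mono-≤ f≤g (x ∷ xs) = +-mono-≤ (f≤g x) (sum-map-mono-≤ f≤g xs)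

ball? : (K : ℕ) → Decidable (λ p → norm₁ p ≤ K)
ball? K p = norm₁ p ≤? K

column : ℕ → ℕ → List Vertex
column a h = map (a ,_) (upTo h)

column-ball-size : ∀ K a h → length (filter (ball? K) (column a h)) ≤ suc (K ∸ a)
column-ball-size K a zero = z≤n
column-ball-size K a (suc h) with a + h ≤? K
... | yes a+h≤K = begin
  length (filter (ball? K) (column a (suc h)))  ≤⟨ length-filter (ball? K) (column a (suc h)) ⟩
  length (column a (suc h))                     ≡⟨ trans (length-map (a ,_) (upTo (suc h))) (length-upTo (suc h)) ⟩
  suc h                                         ≤⟨ s≤s (m+n≤o⇒m≤o∸n h (≤-trans (≤-reflexive (+-comm h a)) a+h≤K)) ⟩
  suc (K ∸ a)                                   ∎
  where open ≤-Reasoning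
... | no a+h≰K = begin
  length (filter (ball? K) (column a (suc h)))                        ≡⟨ cong (length ∘ filter (ball? K)) column-∷ʳ ⟩
  length (filter (ball? K) (column a h ++ [ a , h ]))                 ≡⟨ cong length (filter-++ (ball? K) (column a h) _) ⟩
  length (filter (ball? K) (column a h) ++ filter (ball? K) [ a , h ])
    ≡⟨ cong (λ l → length (filter (ball? K) (column a h) ++ l)) (filter-reject (ball? K) {a , h} {[]} a+h≰K) ⟩
  length (filter (ball? K) (column a h) ++ [])                        ≡⟨ cong length (++-identityʳ (filter (ball? K) (column a h))) ⟩
  length (filter (ball? K) (column a h))                              ≤⟨ column-ball-size K a h ⟩
  suc (K ∸ a)                                                         ∎
  where
  open ≤-Reasoning
  column-∷ʳ : column a (suc h) ≡ column a h ++ [ a , h ]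
  column-∷ʳ = trans (cong (map (a ,_)) (sym (upTo-∷ʳ h))) (map-++ (a ,_) (upTo h) [ h ])

staircase-sum : ∀ K N → N ≤ suc K → 2 * sum (applyUpTo (λ a → suc (K ∸ a)) N) + N * N ≡ N * (2 * K + 3)
staircase-sum K       zero          _           = refl
staircase-sum zero    (suc zero)    _           = refl
staircase-sum zero    (suc (suc N)) (s≤s ())
staircase-sum (suc K) (suc N)       (s≤s N≤1+K) = begin
  2 * (suc (suc K) + S) + suc N * suc N  ≡⟨ peel K N S ⟩
  (2 * S + N * N) + (2 * K + 5 + 2 * N)  ≡⟨ cong (_+ (2 * K + 5 + 2 * N)) (staircase-sum K N N≤1+K) ⟩
  N * (2 * K + 3) + (2 * K + 5 + 2 * N)  ≡⟨ merge K N ⟩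
  suc N * (2 * suc K + 3)                ∎
  where
  open ≡-Reasoning
  S : ℕ
  S = sum (applyUpTo (λ a → suc (K ∸ a)) N)
  peel : ∀ K N S → 2 * (suc (suc K) + S) + suc N * suc N ≡ (2 * S + N * N) + (2 * K + 5 + 2 * N)
  peel = solve-∀
  merge : ∀ K N → N * (2 * K + 3) + (2 * K + 5 + 2 * N) ≡ suc N * (2 * suc K + 3)
  merge = solve-∀

grid-ball-size : ∀ n K → n ≤ K → 2 * length (filter (ball? K) (gridList n)) + suc n * suc n ≤ suc n * (2 * K + 3)
grid-ball-size n K n≤K = begin
  2 * length (filter (ball? K) (gridList n)) + N * N
    ≡⟨ cong (λ c → 2 * c + N * N) (length-filter-concatMap (ball? K) (λ a → column a N) (upTo N)) ⟩
  2 * sum (map (λ a → length (filter (ball? K) (column a N))) (upTo N)) + N * N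
    ≤⟨ +-monoˡ-≤ (N * N) (*-monoʳ-≤ 2 (sum-map-mono-≤ (λ a → column-ball-size K a N) (upTo N))) ⟩
  2 * sum (map (λ a → suc (K ∸ a)) (upTo N)) + N * N
    ≡⟨ cong (λ l → 2 * sum l + N * N) (map-upTo (λ a → suc (K ∸ a)) N) ⟩
  2 * sum (applyUpTo (λ a → suc (K ∸ a)) N) + N * N
    ≡⟨ staircase-sum K N (s≤s n≤K) ⟩
  N * (2 * K + 3)
    ∎
  where
  open ≤-Reasoning
  N : ℕ
  N = suc n

card-bound : ∀ v n c → (∀ p → burned v n p ≡ true → norm₁ p ≤ n + c) →
             2 * card v n ≤ (n + 2) * (n + 1) + 2 * c * (n + 1)
card-bound v n c burned⇒near = +-cancelʳ-≤ (suc n * suc n) (2 * card v n) _ (begin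
  2 * card v n + suc n * suc n                                      ≤⟨ +-monoˡ-≤ (suc n * suc n) (*-monoʳ-≤ 2 card≤ball) ⟩
  2 * length (filter (ball? (n + c)) (gridList n)) + suc n * suc n  ≤⟨ grid-ball-size n (n + c) (m≤m+n n c) ⟩
  suc n * (2 * (n + c) + 3)                                         ≡⟨ regroup n c ⟩
  (n + 2) * (n + 1) + 2 * c * (n + 1) + suc n * suc n               ∎)
  where
  open ≤-Reasoning
  card≤ball : card v n ≤ length (filter (ball? (n + c)) (gridList n))
  card≤ball = length-mono-≤ (filter⁺ (λ p → burned v n p ≟ᵇ true) (ball? (n + c)) (λ { refl → burned⇒near _ }) ⊆-refl)
  regroup : ∀ n c → suc n * (2 * (n + c) + 3) ≡ (n + 2) * (n + 1) + 2 * c * (n + 1) + suc n * suc n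
  regroup = solve-∀

power-of-two-bracket : ∀ n → 1 ≤ n → ∃[ m ] 2 ^ m ≤ n × n < 2 ^ suc m
power-of-two-bracket (suc zero)    _ = 0 , ≤-refl , s≤s (s≤s z≤n)
power-of-two-bracket (suc (suc n)) _ with power-of-two-bracket (suc n) (s≤s z≤n)
... | m , lo , hi with m≤n⇒m<n∨m≡n hi
...   | inj₁ below = m , m≤n⇒m≤1+n lo , below
...   | inj₂ equal = suc m , ≤-reflexive (sym equal) ,
                     subst (λ e → suc (suc n) < 2 * e) equal (m<m+n (suc (suc n)) (s≤s z≤n))

lemma5 : (v : Activation) → Valid v → Greedy v → (v 1 ≡ nothing ⊎ v 2 ≡ nothing) →
    ∀ n → 1 ≤ n →
      2 ^ (2 * card v n ∸ ((n + 2) * (n + 1) + 4 * (n + 1))) ≤ n ^ (2 * (n + 1))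
lemma5 v valid greedy quiet n 1≤n with power-of-two-bracket n 1≤n
... | m , 2^m≤n , n<2^[1+m] = begin
  2 ^ (2 * card v n ∸ X)   ≤⟨ ^-monoʳ-≤ 2 exponent≤ ⟩
  2 ^ (m * (2 * (n + 1)))  ≡⟨ ^-*-assoc 2 m (2 * (n + 1)) ⟨
  (2 ^ m) ^ (2 * (n + 1))  ≤⟨ ^-monoˡ-≤ (2 * (n + 1)) 2^m≤n ⟩
  n ^ (2 * (n + 1))        ∎
  where
  open ≤-Reasoning
  X : ℕ
  X = (n + 2) * (n + 1) + 4 * (n + 1)
  near : NearFiresBefore v (m + 2) (suc n)
  near k≤n = far⇒near (far-fires valid greedy quiet (suc m)) (≤-trans k≤n (≤-trans n<2^[1+m] (m≤m+n _ _)))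
  regroup : ∀ n m → (n + 2) * (n + 1) + 2 * (m + 2) * (n + 1) ≡ (n + 2) * (n + 1) + 4 * (n + 1) + m * (2 * (n + 1))
  regroup = solve-∀
  exponent≤ : 2 * card v n ∸ X ≤ m * (2 * (n + 1))
  exponent≤ = m≤n+o⇒m∸n≤o (2 * card v n) X (begin
    2 * card v n                                ≤⟨ card-bound v n (m + 2) (λ p → burned⇒norm₁≤ near) ⟩
    (n + 2) * (n + 1) + 2 * (m + 2) * (n + 1)   ≡⟨ regroup n m ⟩
    X + m * (2 * (n + 1))                       ∎)
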